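{- Let $\mathbf{L}$ be any axiomatic extension of $\mathbf{GV}$. For all $\Gamma\cup\{\varphi\}\subseteq Fm_{\mathcal L}$ the following are equivalent: (1) $\Gamma\vdash_{\mathbf L}\varphi$; (2) $\{\Box^n\gamma\mid\gamma\in\Gamma\text{ and }n\in\mathbb N\}\vdash_{\mathbf L}\varphi$; (3) there exist a finite subset $\Gamma_0\subseteq\Gamma$ and $n_0\in\mathbb N$ such that $\{\Box^n\gamma\mid\gamma\in\Gamma_0\text{ and }n\le n_0\}\vdash_{\mathbf L}\varphi$.
   Context: $\mathcal L$ is the language $\{\land,\lor,\to,0,1\}$ expanded with a binary counterfactual connective $\mathbin{\Box\!\!\rightarrow}$, $\neg x := x\to 0$. $\mathbf{GV}$ is the smallest finitary consequence relation containing the classical propositional axioms, (L1) $\varphi\mathbin{\Box\!\!\rightarrow}\varphi$, (L2) $((\varphi\mathbin{\Box\!\!\rightarrow}\psi)\wedge(\psi\mathbin{\Box\!\!\rightarrow}\varphi))\to((\varphi\mathbin{\Box\!\!\rightarrow}\gamma)\leftrightarrow(\psi\mathbin{\Box\!\!\rightarrow}\gamma))$, (L3) $((\varphi\vee\psi)\mathbin{\Box\!\!\rightarrow}\varphi)\vee((\varphi\vee\psi)\mathbin{\Box\!\!\rightarrow}\psi)\vee(((\varphi\vee\psi)\mathbin{\Box\!\!\rightarrow}\gamma)\leftrightarrow((\varphi\mathbin{\Box\!\!\rightarrow}\gamma)\wedge(\psi\mathbin{\Box\!\!\rightarrow}\gamma)))$, (L4) $(\varphi\mathbin{\Box\!\!\rightarrow}(\psi\land\gamma))\leftrightarrow((\varphi\mathbin{\Box\!\!\rightarrow}\psi)\land(\varphi\mathbin{\Box\!\!\rightarrow}\gamma))$,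 and closed under modus ponens and the rule (C) $\varphi\to\psi\vdash(\gamma\mathbin{\Box\!\!\rightarrow}\varphi)\to(\gamma\mathbin{\Box\!\!\rightarrow}\psi)$. Define $\Box\varphi:=\neg\varphi\mathbin{\Box\!\!\rightarrow}\varphi$, $\Box^0\varphi:=\varphi$, $\Box^{n+1}\varphi:=\Box\Box^n\varphi$. -}

module Defs where

open import Data.Nat using (ℕ; zero; suc; _≤_)
open import Data.Product using (Σ; _×_; ∃-syntax)
open import Data.List using (List)
open import Data.List.Membership.Propositional using (_∈_)
open import Relation.Binary.PropositionalEquality using (_≡_)

infixr 30 _∧_
infixr 29 _∨_
infixr 28 _⇒_
infixr 27 _□→_

data Fm : Set where
  var  : ℕ → Fm
  _∧_  : Fm → Fm → Fm
  _∨_  : Fm → Fm → Fm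
  _⇒_  : Fm → Fm → Fm
  ⊥'   : Fm
  ⊤'   : Fm
  _□→_ : Fm → Fm → Fm

~_ : Fm → Fm
~ x = x ⇒ ⊥'

_⇔_ : Fm → Fm → Fm
a ⇔ b = (a ⇒ b) ∧ (b ⇒ a)

□ : Fm → Fm
□ φ = (~ φ) □→ φ

□^ : ℕ → Fm → Fm
□^ zero φ = φ
□^ (suc n) φ = □ (□^ n φ)

subst : (ℕ → Fm) → Fm → Fm
subst σ (var x) = σ x
subst σ (a ∧ b) = subst σ a ∧ subst σ b
subst σ (a ∨ b) = subst σ a ∨ subst σ b
subst σ (a ⇒ b) = subst σ a ⇒ subst σ b
subst σ ⊥' = ⊥'
subst σ ⊤' = ⊤'
subst σ (a □→ b) = subst σ a □→ subst σ b

-- Axioms of GV (as schemata: every instance with arbitrary formulas).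
-- Classical propositional axioms: a standard complete Hilbert system for
-- classical logic in the signature {∧,∨,→,0,1}.
data GVAxiom : Fm → Set where
  A1  : ∀ φ ψ → GVAxiom (φ ⇒ (ψ ⇒ φ))
  A2  : ∀ φ ψ χ → GVAxiom ((φ ⇒ (ψ ⇒ χ)) ⇒ ((φ ⇒ ψ) ⇒ (φ ⇒ χ)))
  A3  : ∀ φ ψ → GVAxiom ((φ ∧ ψ) ⇒ φ)
  A4  : ∀ φ ψ → GVAxiom ((φ ∧ ψ) ⇒ ψ)
  A5  : ∀ φ ψ → GVAxiom (φ ⇒ (ψ ⇒ (φ ∧ ψ)))
  A6  : ∀ φ ψ → GVAxiom (φ ⇒ (φ ∨ ψ))
  A7  : ∀ φ ψ → GVAxiom (ψ ⇒ (φ ∨ ψ))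
  A8  : ∀ φ ψ χ → GVAxiom ((φ ⇒ χ) ⇒ ((ψ ⇒ χ) ⇒ ((φ ∨ ψ) ⇒ χ)))
  A9  : ∀ φ → GVAxiom (⊥' ⇒ φ)
  A10 : GVAxiom ⊤'
  A11 : ∀ φ → GVAxiom (~ (~ φ) ⇒ φ)
  L1  : ∀ φ → GVAxiom (φ □→ φ)
  L2  : ∀ φ ψ γ → GVAxiom (((φ □→ ψ) ∧ (ψ □→ φ)) ⇒ ((φ □→ γ) ⇔ (ψ □→ γ)))
  L3  : ∀ φ ψ γ → GVAxiom ((((φ ∨ ψ) □→ φ) ∨ ((φ ∨ ψ) □→ ψ))
                          ∨ (((φ ∨ ψ) □→ γ) ⇔ ((φ □→ γ) ∧ (ψ □→ γ))))
  L4  : ∀ φ ψ γ → GVAxiom ((φ □→ (ψ ∧ γ)) ⇔ ((φ □→ ψ) ∧ (φ □→ γ)))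

-- Consequence relation of the axiomatic extension of GV by the set of
-- axioms Ax (closed under substitution: every substitution instance of
-- a member of Ax is an axiom).  Rules MP and (C) apply to all derived
-- formulas, including those depending on premises.
data _⊢[_]_ (Γ : Fm → Set) (Ax : Fm → Set) : Fm → Set where
  hyp  : ∀ {φ} → Γ φ → Γ ⊢[ Ax ] φ
  gv   : ∀ {φ} → GVAxiom φ → Γ ⊢[ Ax ] φ
  ext  : ∀ {φ} (σ : ℕ → Fm) → Ax φ → Γ ⊢[ Ax ] subst σ φ
  mp   : ∀ {φ ψ} → Γ ⊢[ Ax ] φ → Γ ⊢[ Ax ] (φ ⇒ ψ) → Γ ⊢[ Ax ] ψ
  ruleC : ∀ {φ ψ} γ → Γ ⊢[ Ax ] (φ ⇒ ψ) → Γ ⊢[ Ax ] ((γ □→ φ) ⇒ (γ □→ ψ))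

BoxClosure : (Fm → Set) → Fm → Set
BoxClosure Γ ψ = Σ Fm λ γ → Σ ℕ λ n → Γ γ × (ψ ≡ □^ n γ)

BoxBounded : List Fm → ℕ → Fm → Set
BoxBounded Γ₀ n₀ ψ = Σ Fm λ γ → Σ ℕ λ n → (γ ∈ Γ₀) × (n ≤ n₀) × (ψ ≡ □^ n γ)

{-# OPTIONS --safe #-}
module Submission where

open import Defs
open import Data.Nat using (ℕ; zero; suc; _≤_; _⊔_)
open import Data.Nat.Properties using (≤-trans; m≤m⊔n; m≤n⊔m)
open import Data.Product using (Σ; _×_; _,_)
open import Data.List using (List; []; _∷_; _++_)
open import Data.List.Relation.Unary.All as All using (All; []; _∷_)
open import Data.List.Relation.Unary.All.Properties using (++⁺)
open import Data.List.Relation.Unary.Any using (here; there)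
open import Data.List.Membership.Propositional using (_∈_)
open import Data.List.Relation.Binary.Subset.Propositional using () renaming (_⊆_ to _⊆ˡ_)
open import Data.List.Relation.Binary.Subset.Propositional.Properties
  using (xs⊆x∷xs; xs⊆xs++ys; xs⊆ys++xs)
open import Relation.Binary.PropositionalEquality using (refl)
open import Relation.Unary using (_⊆_)

-- A derivation uses only finitely many premises, each of the form □ⁿγ with n bounded.
-- Conversely □ⁿγ follows from γ: rule (C) applies to derivations from premises, so
-- necessitation holds relative to Γ and the boxed premises add nothing.

cut : ∀ {Ax Γ Δ φ} → (∀ {ψ} → Δ ψ → Γ ⊢[ Ax ] ψ) → Δ ⊢[ Ax ] φ → Γ ⊢[ Ax ] φ
cut f (hyp δ)     = f δ
cut f (gv a)      = gv a
cut f (ext σ a)   = ext σ a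
cut f (mp d e)    = mp (cut f d) (cut f e)
cut f (ruleC γ d) = ruleC γ (cut f d)

⊢-mono : ∀ {Ax Γ Δ φ} → Δ ⊆ Γ → Δ ⊢[ Ax ] φ → Γ ⊢[ Ax ] φ
⊢-mono Δ⊆Γ = cut (λ δ → hyp (Δ⊆Γ δ))

⊢-finite : ∀ {Ax Γ φ} → Γ ⊢[ Ax ] φ → Σ (List Fm) λ Γ₀ → All Γ Γ₀ × ((_∈ Γ₀) ⊢[ Ax ] φ)
⊢-finite {φ = φ} (hyp γ) = φ ∷ [] , γ ∷ [] , hyp (here refl)
⊢-finite (gv a)          = [] , [] , gv a
⊢-finite (ext σ a)       = [] , [] , ext σ a
⊢-finite (mp d e) with ⊢-finite d | ⊢-finite e
... | Γ₁ , all₁ , d₁ | Γ₂ , all₂ , e₂ =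
  Γ₁ ++ Γ₂ , ++⁺ all₁ all₂ , mp (⊢-mono (xs⊆xs++ys Γ₁ Γ₂) d₁) (⊢-mono (xs⊆ys++xs Γ₂ Γ₁) e₂)
⊢-finite (ruleC γ d) with ⊢-finite d
... | Γ₀ , all₀ , d₀ = Γ₀ , all₀ , ruleC γ d₀

-- (C) applied to ψ → (¬ψ → ψ) turns the instance ¬ψ □→ ¬ψ of (L1) into □ψ.
necessitation : ∀ {Ax Γ ψ} → Γ ⊢[ Ax ] ψ → Γ ⊢[ Ax ] □ ψ
necessitation {ψ = ψ} d = mp (gv (L1 (~ ψ))) (ruleC (~ ψ) (mp d (gv (A1 ψ (~ ψ)))))

necessitation^ : ∀ {Ax Γ ψ} n → Γ ⊢[ Ax ] ψ → Γ ⊢[ Ax ] □^ n ψ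
necessitation^ zero    d = d
necessitation^ (suc n) d = necessitation (necessitation^ n d)

⊆-BoxClosure : (Γ : Fm → Set) → Γ ⊆ BoxClosure Γ
⊆-BoxClosure Γ {γ} g = γ , 0 , g , refl

BoxBounded-mono : ∀ {Γ₀ Γ₁ n₀ n₁} → Γ₀ ⊆ˡ Γ₁ → n₀ ≤ n₁ → BoxBounded Γ₀ n₀ ⊆ BoxBounded Γ₁ n₁
BoxBounded-mono Γ₀⊆Γ₁ n₀≤n₁ (γ , n , γ∈Γ₀ , n≤n₀ , eq) = γ , n , Γ₀⊆Γ₁ γ∈Γ₀ , ≤-trans n≤n₀ n₀≤n₁ , eq

BoxBounded-derivable : ∀ {Ax Γ Γ₀ n₀} → All Γ Γ₀ → BoxBounded Γ₀ n₀ ⊆ (Γ ⊢[ Ax ]_)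
BoxBounded-derivable all₀ (γ , n , γ∈Γ₀ , _ , refl) = necessitation^ n (hyp (All.lookup all₀ γ∈Γ₀))

BoxClosure-bounded : ∀ {Γ Δ} → All (BoxClosure Γ) Δ →
  Σ (List Fm) λ Γ₀ → Σ ℕ λ n₀ → All Γ Γ₀ × ((_∈ Δ) ⊆ BoxBounded Γ₀ n₀)
BoxClosure-bounded [] = [] , 0 , [] , λ ()
BoxClosure-bounded ((γ , n , g , refl) ∷ rest) with BoxClosure-bounded rest
... | Γ₀ , n₀ , all₀ , rest⊆ = γ ∷ Γ₀ , n ⊔ n₀ , g ∷ all₀ , λ
  { (here refl) → γ , n , here refl , m≤m⊔n n n₀ , refl
  ; (there δ)   → BoxBounded-mono (xs⊆x∷xs Γ₀ γ) (m≤n⊔m n n₀) (rest⊆ δ)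
  }

BoxClosure-compact : ∀ {Ax Γ φ} → BoxClosure Γ ⊢[ Ax ] φ →
  Σ (List Fm) λ Γ₀ → Σ ℕ λ n₀ → All Γ Γ₀ × (BoxBounded Γ₀ n₀ ⊢[ Ax ] φ)
BoxClosure-compact d with ⊢-finite d
... | Δ , allΔ , d₀ with BoxClosure-bounded allΔ
...   | Γ₀ , n₀ , all₀ , Δ⊆ = Γ₀ , n₀ , all₀ , ⊢-mono Δ⊆ d₀

proposition3p29 : (Ax : Fm → Set) (Γ : Fm → Set) (φ : Fm) →
    ((Γ ⊢[ Ax ] φ) → (BoxClosure Γ ⊢[ Ax ] φ))
    × ((BoxClosure Γ ⊢[ Ax ] φ) →
        Σ (List Fm) λ Γ₀ → Σ ℕ λ n₀ → All Γ Γ₀ × (BoxBounded Γ₀ n₀ ⊢[ Ax ] φ))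
    × ((Σ (List Fm) λ Γ₀ → Σ ℕ λ n₀ → All Γ Γ₀ × (BoxBounded Γ₀ n₀ ⊢[ Ax ] φ)) →
        (Γ ⊢[ Ax ] φ))
proposition3p29 Ax Γ φ =
  ⊢-mono (⊆-BoxClosure Γ) ,
  BoxClosure-compact ,
  λ { (Γ₀ , n₀ , all₀ , d) → cut (BoxBounded-derivable all₀) d }
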